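{- Let $\mathbf{s}=(s_1,\ldots,s_a)$ be a composition with $s_1,s_a\ge 1$ and $s_i\ge 2$ for all $1<i<a$. Let $n = 1+s_1+\cdots+s_a-a$, let $\mathbf{u} = (s_1,s_1+s_2-1,\ldots,s_1+\cdots+s_{a-1}-(a-2))$, and let $\mathbf{t}$ consist of the ordered list of the elements in $[n]$ not in $\mathbf{u}$. Then $|\mathcal{DP}_{\mathbf{s}}|=|\mathrm{IPC}_n(\mathbf{t})|$.
   Context: Let $[n]=\{1,\dots,n\}$. For a weakly increasing sequence $\mathbf{p}=(p_1,\dots,p_q)$ of positive integers, $L(\mathbf{p})$ is the lattice path of right and up steps starting at $(1,1)$ having, for each $i$, an up step at $x$-coordinate $p_i$. For a composition $\mathbf{s}=(s_1,\dots,s_a)$ (sequence of positive integers), set $\tilde L(\mathbf{s})=L\big(s_1,\ s_1+s_2-1,\ \dots,\ \sum_{i=1}^j s_i-(j-1),\ \dots\big)$, and let $|\mathbf{s}|=s_1+\cdots+s_a$, $\ell(\mathbf{s})=a$. A Dyck path with signature $\mathbf{s}$ ($\mathbf{s}$-Dyck path) is a lattice path of right and up steps from $(1,1)$ to $(|\mathbf{s}|-\ell(\mathbf{s})+1,\ell(\mathbf{s}))$ lying weakly above and to the left of $\tilde L(\mathbf{s})$; $\mathcal{DP}_\mathbf{s}$ is the set of all such paths. For a strictly increasing list $\mathbf{t}=(t_1,\dots,t_m)$ of elements of $[n]$ with increasing complement $\mathbf{u}=(u_1,\dots,u_{n-m})$ in $[n]$, $\mathrm{IPC}_n(\mathbf{t})$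 is the set of weakly increasing sequences $(c_1,\dots,c_{n-m})\in[n]^{n-m}$ with $c_i\le u_i$ for all $i$ (increasing parking completions of $\mathbf{t}$). -}

module Defs where

open import Data.Nat using (ℕ; zero; suc; _+_; _∸_; _≤_; _<_)
open import Data.Nat.Properties using (_≟_)
open import Data.List using (List; []; _∷_; length; take; filter; map; upTo)
open import Data.Nat.ListAction using (sum)
open import Data.List.Relation.Unary.All using (All)
open import Data.List.Relation.Unary.Linked using (Linked)
open import Data.List.Relation.Binary.Pointwise using (Pointwise)
open import Data.List.Membership.DecPropositional _≟_ using (_∈?_)
open import Data.Fin using (Fin; toℕ)
open import Data.List using (lookup)
open import Data.Product using (Σ; _×_)
open import Relation.Binary.PropositionalEquality using (_≡_)
open import Relation.Nullary.Decidable using (¬?)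

range : ℕ → List ℕ
range n = map suc (upTo n)

IsComposition : List ℕ → Set
IsComposition s = (1 ≤ length s) × All (1 ≤_) s

-- s_i ≥ 2 for all 1 < i < a  (0-based: 0 < i and i + 1 < a)
InteriorAtLeast2 : List ℕ → Set
InteriorAtLeast2 s = (i : Fin (length s)) → 0 < toℕ i → suc (toℕ i) < length s →
                     2 ≤ lookup s i

data Step : Set where
  R U : Step

upXsFrom : ℕ → List Step → List ℕ
upXsFrom x []       = []
upXsFrom x (R ∷ ps) = upXsFrom (suc x) ps
upXsFrom x (U ∷ ps) = x ∷ upXsFrom x ps

upXs : List Step → List ℕ
upXs = upXsFrom 1

count : Step → List Step → ℕ
count s [] = 0
count R (R ∷ ps) = suc (count R ps)
count R (U ∷ ps) = count R ps
count U (U ∷ ps) = suc (count U ps)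
count U (R ∷ ps) = count U ps

tildeSeq : ℕ → List ℕ → List ℕ
tildeSeq k s = map (λ j → sum (take j s) ∸ (j ∸ 1)) (map suc (upTo k))

-- path P ends at (1 + #R, 1 + #U); P lies weakly above and to the left of L(p)
-- (p weakly increasing, with #U(P) = length p): the i-th up step of P occurs at
-- x-coordinate ≤ p_i.
WeaklyAboveLeft : List Step → List ℕ → Set
WeaklyAboveLeft P p = Pointwise _≤_ (upXs P) p

-- s-Dyck paths: from (1,1) to (|s| - ℓ(s) + 1, ℓ(s)), weakly above/left of L~(s).
-- L~(s) has its up steps (at heights 1 .. ℓ(s)-1) at x = tildeSeq (ℓ(s) - 1) s.
IsDyckPath : List ℕ → List Step → Set
IsDyckPath s P =
  (count R P ≡ sum s ∸ length s) ×
  (count U P ≡ length s ∸ 1) ×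
  WeaklyAboveLeft P (tildeSeq (length s ∸ 1) s)

DP : List ℕ → Set
DP s = Σ (List Step) (IsDyckPath s)

complement : ℕ → List ℕ → List ℕ
complement n t = filter (λ k → ¬? (k ∈? t)) (range n)

IsIPC : ℕ → List ℕ → List ℕ → Set
IsIPC n t c =
  All (λ x → 1 ≤ x × x ≤ n) c ×
  Linked _≤_ c ×
  Pointwise _≤_ c (complement n t)

IPC : ℕ → List ℕ → Set
IPC n t = Σ (List ℕ) (IsIPC n t)

nOf : List ℕ → ℕ
nOf s = (1 + sum s) ∸ length s

uOf : List ℕ → List ℕ
uOf s = tildeSeq (length s ∸ 1) s

tOf : List ℕ → List ℕ
tOf s = complement (nOf s) (uOf s)

module Submission where

-- A lattice path is determined by the x-coordinates of its up steps, which form a weakly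
-- increasing sequence in [n]; lying weakly above L̃(s) says exactly that this sequence is
-- bounded entrywise by u, the up-step positions of L̃(s). So s-Dyck paths correspond to
-- weakly increasing sequences in [n] dominated by u. Since s_i ≥ 2 in the interior, u is
-- strictly increasing (its gaps are s_i − 1) and lies in [n], so u is the increasing
-- complement of its own complement t, and these sequences are the parking completions of t.

open import Defs
open import Data.Nat using (ℕ; zero; suc; _+_; _∸_; _≤_; _<_; z≤n; s≤s)
open import Data.Nat.Properties
open import Data.List using (List; []; _∷_; length; map; upTo; applyUpTo; replicate; _++_; take)
open import Data.List.Properties using (length-map; length-upTo; map-upTo; map-applyUpTo)
open import Data.Nat.ListAction using (sum)
open import Data.List.Relation.Unary.All as All using (All; []; _∷_)
open import Data.List.Relation.Unary.Any using (here; there)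
open import Data.List.Relation.Unary.AllPairs using (AllPairs; []; _∷_)
open import Data.List.Relation.Unary.Linked as Linked using (Linked; []; [-]; _∷_)
open import Data.List.Relation.Unary.Linked.Properties
  using (Linked⇒All; Linked⇒AllPairs; map⁺; applyUpTo⁺₂; filter⁺)
open import Data.List.Relation.Binary.Pointwise as Pointwise using (Pointwise; Pointwise-length)
open import Data.List.Relation.Binary.Subset.Propositional using (_⊆_)
open import Data.List.Membership.Propositional using (_∈_; _∉_)
open import Data.List.Membership.Propositional.Properties using (∈-map⁺; ∈-upTo⁺; ∈-filter⁺; ∈-filter⁻)
open import Data.List.Membership.DecPropositional _≟_ using (_∈?_)
open import Data.Fin as Fin using ()
open import Data.Product using (Σ; _×_; _,_; proj₁; proj₂)
open import Data.Product.Properties using (Σ-≡,≡→≡)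
open import Relation.Nullary using (yes; no; contradiction)
open import Relation.Nullary.Decidable using (¬?)
open import Relation.Binary.PropositionalEquality
open import Function using (id)
open import Function.Bundles using (_↔_; mk↔ₛ′)

[n∸m]+[o∸n]≡o∸m : ∀ {m n o} → m ≤ n → n ≤ o → (n ∸ m) + (o ∸ n) ≡ o ∸ m
[n∸m]+[o∸n]≡o∸m {m} {n} {o} m≤n n≤o = begin
  (n ∸ m) + (o ∸ n)  ≡⟨ +-comm (n ∸ m) (o ∸ n) ⟩
  (o ∸ n) + (n ∸ m)  ≡⟨ +-∸-assoc (o ∸ n) m≤n ⟨
  (o ∸ n + n) ∸ m    ≡⟨ cong (_∸ m) (m∸n+n≡m n≤o) ⟩
  o ∸ m              ∎
  where open ≡-Reasoning

∷-linked⁺ : ∀ {x cs} → All (x ≤_) cs → Linked _≤_ cs → Linked _≤_ (x ∷ cs)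
∷-linked⁺ []          []     = [-]
∷-linked⁺ (x≤c ∷ _)   sorted = x≤c ∷ sorted

∷-linked⁻ : ∀ {x cs} → Linked _≤_ (x ∷ cs) → All (x ≤_) cs
∷-linked⁻ sorted = All.tail (Linked⇒All ≤-trans ≤-refl sorted)

∷-linked-weaken : ∀ {a b cs} → a ≤ b → Linked _≤_ (b ∷ cs) → Linked _≤_ (a ∷ cs)
∷-linked-weaken a≤b [-]            = [-]
∷-linked-weaken a≤b (b≤c ∷ sorted) = ≤-trans a≤b b≤c ∷ sorted

upXsFrom-linked : ∀ x P → Linked _≤_ (x ∷ upXsFrom x P)
upXsFrom-linked x []      = [-]
upXsFrom-linked x (R ∷ P) = ∷-linked-weaken (n≤1+n x) (upXsFrom-linked (suc x) P)
upXsFrom-linked x (U ∷ P) = ≤-refl ∷ upXsFrom-linked x P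

upXsFrom-bounded : ∀ x P → All (_≤ x + count R P) (upXsFrom x P)
upXsFrom-bounded x []      = []
upXsFrom-bounded x (R ∷ P) =
  All.map (λ c≤ → ≤-trans c≤ (≤-reflexive (sym (+-suc x (count R P))))) (upXsFrom-bounded (suc x) P)
upXsFrom-bounded x (U ∷ P) = m≤m+n x (count R P) ∷ upXsFrom-bounded x P

upXsFrom-rights : ∀ d x P → upXsFrom x (replicate d R ++ P) ≡ upXsFrom (d + x) P
upXsFrom-rights zero    x P = refl
upXsFrom-rights (suc d) x P =
  trans (upXsFrom-rights d (suc x) P) (cong (λ y → upXsFrom y P) (+-suc d x))

upXsFrom-replicate : ∀ d x → upXsFrom x (replicate d R) ≡ []
upXsFrom-replicate zero    x = refl
upXsFrom-replicate (suc d) x = upXsFrom-replicate d (suc x)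

countR-rights : ∀ d P → count R (replicate d R ++ P) ≡ d + count R P
countR-rights zero    P = refl
countR-rights (suc d) P = cong suc (countR-rights d P)

countU-rights : ∀ d P → count U (replicate d R ++ P) ≡ count U P
countU-rights zero    P = refl
countU-rights (suc d) P = countU-rights d P

countR-replicate : ∀ d → count R (replicate d R) ≡ d
countR-replicate zero    = refl
countR-replicate (suc d) = cong suc (countR-replicate d)

countU-replicate : ∀ d → count U (replicate d R) ≡ 0
countU-replicate zero    = refl
countU-replicate (suc d) = countU-replicate d

pathFrom : ℕ → ℕ → List ℕ → List Step
pathFrom x e []       = replicate (e ∸ x) R
pathFrom x e (c ∷ cs) = replicate (c ∸ x) R ++ U ∷ pathFrom c e cs

upXsFrom-pathFrom : ∀ x e cs → Linked _≤_ (x ∷ cs) → upXsFrom x (pathFrom x e cs) ≡ cs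
upXsFrom-pathFrom x e []       _                = upXsFrom-replicate (e ∸ x) x
upXsFrom-pathFrom x e (c ∷ cs) (x≤c ∷ sorted) = begin
  upXsFrom x (replicate (c ∸ x) R ++ rest) ≡⟨ upXsFrom-rights (c ∸ x) x rest ⟩
  upXsFrom (c ∸ x + x) rest                 ≡⟨ cong (λ y → upXsFrom y rest) (m∸n+n≡m x≤c) ⟩
  c ∷ upXsFrom c (pathFrom c e cs)          ≡⟨ cong (c ∷_) (upXsFrom-pathFrom c e cs sorted) ⟩
  c ∷ cs                                    ∎
  where
  open ≡-Reasoning
  rest : List Step
  rest = U ∷ pathFrom c e cs

countU-pathFrom : ∀ x e cs → count U (pathFrom x e cs) ≡ length cs
countU-pathFrom x e []       = countU-replicate (e ∸ x)
countU-pathFrom x e (c ∷ cs) = trans (countU-rights (c ∸ x) _) (cong suc (countU-pathFrom c e cs))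

countR-pathFrom : ∀ x e cs → Linked _≤_ (x ∷ cs) → All (_≤ e) cs → count R (pathFrom x e cs) ≡ e ∸ x
countR-pathFrom x e []       _                _              = countR-replicate (e ∸ x)
countR-pathFrom x e (c ∷ cs) (x≤c ∷ sorted) (c≤e ∷ bounded) = begin
  count R (replicate (c ∸ x) R ++ U ∷ pathFrom c e cs)
    ≡⟨ countR-rights (c ∸ x) _ ⟩
  (c ∸ x) + count R (pathFrom c e cs)
    ≡⟨ cong ((c ∸ x) +_) (countR-pathFrom c e cs sorted bounded) ⟩
  (c ∸ x) + (e ∸ c)
    ≡⟨ [n∸m]+[o∸n]≡o∸m x≤c c≤e ⟩
  e ∸ x
    ∎
  where open ≡-Reasoning

pathFrom-rightStep : ∀ {x e} cs → suc x ≤ e → Linked _≤_ (suc x ∷ cs) →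
                     pathFrom x e cs ≡ R ∷ pathFrom (suc x) e cs
pathFrom-rightStep {x} {suc e} []           (s≤s x≤e) _ =
  cong (λ d → replicate d R) (+-∸-assoc 1 x≤e)
pathFrom-rightStep {x} {e}     (suc c ∷ cs) _ (s≤s x≤c ∷ _) =
  cong (λ d → replicate d R ++ U ∷ pathFrom (suc c) e cs) (+-∸-assoc 1 x≤c)

pathFrom-upXsFrom : ∀ x P {e} → x + count R P ≡ e → pathFrom x e (upXsFrom x P) ≡ P
pathFrom-upXsFrom x []      refl = cong (λ d → replicate d R) (m+n∸m≡n x 0)
pathFrom-upXsFrom x (U ∷ P) eq   rewrite n∸n≡0 x = cong (U ∷_) (pathFrom-upXsFrom x P eq)
pathFrom-upXsFrom x (R ∷ P) {e} eq = begin
  pathFrom x e (upXsFrom (suc x) P)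
    ≡⟨ pathFrom-rightStep _ suc-x≤e (upXsFrom-linked (suc x) P) ⟩
  R ∷ pathFrom (suc x) e (upXsFrom (suc x) P)
    ≡⟨ cong (R ∷_) (pathFrom-upXsFrom (suc x) P (trans (sym (+-suc x _)) eq)) ⟩
  R ∷ P
    ∎
  where
  open ≡-Reasoning
  suc-x≤e : suc x ≤ e
  suc-x≤e = subst (suc x ≤_) eq (m<m+n x (s≤s z≤n))

-- For s with positive parts, tildeSeqFrom c s is uOf s with c added to every entry.
tildeSeqFrom : ℕ → List ℕ → List ℕ
tildeSeqFrom c []           = []
tildeSeqFrom c (_ ∷ [])     = []
tildeSeqFrom c (x ∷ y ∷ ys) = c + x ∷ tildeSeqFrom (c + x ∸ 1) (y ∷ ys)

length≤sum : ∀ {s} → All (1 ≤_) s → length s ≤ sum s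
length≤sum []               = z≤n
length≤sum (1≤x ∷ positive) = +-mono-≤ 1≤x (length≤sum positive)

+-∸-carry : ∀ c x S j → 1 ≤ x → (c + (x + S)) ∸ suc j ≡ (c + x ∸ 1 + S) ∸ j
+-∸-carry c (suc x) S j _ rewrite +-suc c x | +-suc c (x + S) | +-assoc c x S = refl

applyUpTo-cong : ∀ {f g : ℕ → ℕ} n → (∀ j → f j ≡ g j) → applyUpTo f n ≡ applyUpTo g n
applyUpTo-cong zero    f≗g = refl
applyUpTo-cong (suc n) f≗g = cong₂ _∷_ (f≗g 0) (applyUpTo-cong n (λ j → f≗g (suc j)))

applyUpTo-tildeSeqFrom : ∀ c s → All (1 ≤_) s →
  applyUpTo (λ j → (c + sum (take (suc j) s)) ∸ j) (length s ∸ 1) ≡ tildeSeqFrom c s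
applyUpTo-tildeSeqFrom c []           _                  = refl
applyUpTo-tildeSeqFrom c (x ∷ [])     _                  = refl
applyUpTo-tildeSeqFrom c (x ∷ y ∷ ys) (1≤x ∷ positive) =
  cong₂ _∷_ (cong (c +_) (+-identityʳ x))
    (trans (applyUpTo-cong (length ys) (λ j → +-∸-carry c x (sum (take (suc j) (y ∷ ys))) j 1≤x))
           (applyUpTo-tildeSeqFrom (c + x ∸ 1) (y ∷ ys) positive))

uOf≡tildeSeqFrom : ∀ {s} → All (1 ≤_) s → uOf s ≡ tildeSeqFrom 0 s
uOf≡tildeSeqFrom {s} positive = begin
  map (λ j → sum (take j s) ∸ (j ∸ 1)) (map suc (upTo k))     ≡⟨ cong (map _) (map-upTo suc k) ⟩
  map (λ j → sum (take j s) ∸ (j ∸ 1)) (applyUpTo suc k)      ≡⟨ map-applyUpTo suc _ k ⟩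
  applyUpTo (λ j → sum (take (suc j) s) ∸ j) k                 ≡⟨ applyUpTo-tildeSeqFrom 0 s positive ⟩
  tildeSeqFrom 0 s                                             ∎
  where
  open ≡-Reasoning
  k : ℕ
  k = length s ∸ 1

length-uOf : ∀ s → length (uOf s) ≡ length s ∸ 1
length-uOf s = trans (length-map _ (map suc (upTo k))) (trans (length-map suc (upTo k)) (length-upTo k))
  where
  k : ℕ
  k = length s ∸ 1

InteriorAtLeast2-tail : ∀ {x xs} → InteriorAtLeast2 (x ∷ xs) → InteriorAtLeast2 xs
InteriorAtLeast2-tail interior i _ i<len = interior (Fin.suc i) (s≤s z≤n) (s≤s i<len)

InteriorAtLeast2-second : ∀ {x y z zs} → InteriorAtLeast2 (x ∷ y ∷ z ∷ zs) → 2 ≤ y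
InteriorAtLeast2-second interior = interior (Fin.suc Fin.zero) (s≤s z≤n) (s≤s (s≤s (s≤s z≤n)))

<-∸1+ : ∀ {d y} → 1 ≤ d → 2 ≤ y → d < d ∸ 1 + y
<-∸1+ {suc d} {suc (suc y)} _ (s≤s (s≤s _)) rewrite +-suc d (suc y) | +-suc d y = s≤s (s≤s (m≤m+n d y))

tildeSeqFrom-strictlyIncreasing : ∀ c s → All (1 ≤_) s → InteriorAtLeast2 s → Linked _<_ (tildeSeqFrom c s)
tildeSeqFrom-strictlyIncreasing c []               _ _ = []
tildeSeqFrom-strictlyIncreasing c (x ∷ [])         _ _ = []
tildeSeqFrom-strictlyIncreasing c (x ∷ y ∷ [])     _ _ = [-]
tildeSeqFrom-strictlyIncreasing c (x ∷ y ∷ z ∷ zs) (1≤x ∷ positive) interior =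
  <-∸1+ (≤-trans 1≤x (m≤n+m x c)) (InteriorAtLeast2-second interior)
  ∷ tildeSeqFrom-strictlyIncreasing (c + x ∸ 1) (y ∷ z ∷ zs) positive (InteriorAtLeast2-tail interior)

tildeSeqFrom-positive : ∀ c s → All (1 ≤_) s → All (1 ≤_) (tildeSeqFrom c s)
tildeSeqFrom-positive c []           _                  = []
tildeSeqFrom-positive c (x ∷ [])     _                  = []
tildeSeqFrom-positive c (x ∷ y ∷ ys) (1≤x ∷ positive) =
  ≤-trans 1≤x (m≤n+m x c) ∷ tildeSeqFrom-positive (c + x ∸ 1) (y ∷ ys) positive

tildeSeqFrom-bounded : ∀ c s → All (1 ≤_) s → All (_≤ suc (c + sum s) ∸ length s) (tildeSeqFrom c s)
tildeSeqFrom-bounded c []           _                  = []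
tildeSeqFrom-bounded c (x ∷ [])     _                  = []
tildeSeqFrom-bounded c (x ∷ y ∷ ys) (1≤x ∷ positive) =
  head ∷ subst (λ b → All (_≤ b) (tildeSeqFrom (c + x ∸ 1) (y ∷ ys))) bound≡
               (tildeSeqFrom-bounded (c + x ∸ 1) (y ∷ ys) positive)
  where
  S L : ℕ
  S = sum (y ∷ ys)
  L = length ys
  bound≡ : (c + x ∸ 1 + S) ∸ L ≡ (c + (x + S)) ∸ suc L
  bound≡ = sym (+-∸-carry c x S L 1≤x)
  head : c + x ≤ (c + (x + S)) ∸ suc L
  head = m+n≤o⇒m≤o∸n (c + x) (begin
    c + x + suc L  ≤⟨ +-monoʳ-≤ (c + x) (length≤sum positive) ⟩
    c + x + S      ≡⟨ +-assoc c x S ⟩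
    c + (x + S)    ∎)
    where open ≤-Reasoning

∈-range⁺ : ∀ {n k} → 1 ≤ k → k ≤ n → k ∈ range n
∈-range⁺ {k = suc k} _ k<n = ∈-map⁺ suc (∈-upTo⁺ k<n)

range-strictlyIncreasing : ∀ n → Linked _<_ (range n)
range-strictlyIncreasing n = map⁺ (applyUpTo⁺₂ id n (λ i → ≤-refl))

complement-strictlyIncreasing : ∀ n t → Linked _<_ (complement n t)
complement-strictlyIncreasing n t = filter⁺ (λ k → ¬? (k ∈? t)) <-trans (range-strictlyIncreasing n)

∈-complement⁺ : ∀ n t {k} → k ∈ range n → k ∉ t → k ∈ complement n t
∈-complement⁺ n t = ∈-filter⁺ (λ k → ¬? (k ∈? t))

∈-complement⁻ : ∀ n t {k} → k ∈ complement n t → k ∈ range n × k ∉ t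
∈-complement⁻ n t = ∈-filter⁻ (λ k → ¬? (k ∈? t)) {xs = range n}

strictlyIncreasing-⊆-antisym : ∀ {xs ys} → AllPairs _<_ xs → AllPairs _<_ ys →
                               xs ⊆ ys → ys ⊆ xs → xs ≡ ys
strictlyIncreasing-⊆-antisym {[]}    {[]}    _ _ _ _ = refl
strictlyIncreasing-⊆-antisym {[]}    {_ ∷ _} _ _ _ ys⊆xs with ys⊆xs (here refl)
... | ()
strictlyIncreasing-⊆-antisym {_ ∷ _} {[]}    _ _ xs⊆ys _ with xs⊆ys (here refl)
... | ()
strictlyIncreasing-⊆-antisym {x ∷ xs} {y ∷ ys} (x<xs ∷ xs<) (y<ys ∷ ys<) xs⊆ys ys⊆xs
  with heads-equal (xs⊆ys (here refl)) (ys⊆xs (here refl))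
  where
  heads-equal : x ∈ y ∷ ys → y ∈ x ∷ xs → x ≡ y
  heads-equal (here x≡y)  _            = x≡y
  heads-equal (there _)   (here y≡x)   = sym y≡x
  heads-equal (there x∈ys) (there y∈xs) =
    contradiction (All.lookup y<ys x∈ys) (<-asym (All.lookup x<xs y∈xs))
... | refl = cong (x ∷_) (strictlyIncreasing-⊆-antisym xs< ys< (⊆-tail x<xs xs⊆ys) (⊆-tail y<ys ys⊆xs))
  where
  ⊆-tail : ∀ {zs ws} → All (x <_) zs → x ∷ zs ⊆ x ∷ ws → zs ⊆ ws
  ⊆-tail x<zs zs⊆ws k∈zs with zs⊆ws (there k∈zs)
  ... | here refl = contradiction (All.lookup x<zs k∈zs) (<-irrefl refl)
  ... | there k∈ws = k∈ws

complement-involutive : ∀ {n u} → Linked _<_ u → All (λ b → 1 ≤ b × b ≤ n) u →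
                        complement n (complement n u) ≡ u
complement-involutive {n} {u} u↑ u⊆[n] = strictlyIncreasing-⊆-antisym
  (Linked⇒AllPairs <-trans (complement-strictlyIncreasing n (complement n u)))
  (Linked⇒AllPairs <-trans u↑) cc⊆u u⊆cc
  where
  cc⊆u : complement n (complement n u) ⊆ u
  cc⊆u {k} k∈cc with k ∈? u | ∈-complement⁻ n (complement n u) k∈cc
  ... | yes k∈u | _               = k∈u
  ... | no  k∉u | k∈[n] , k∉c = contradiction (∈-complement⁺ n u k∈[n] k∉u) k∉c
  u⊆cc : u ⊆ complement n (complement n u)
  u⊆cc k∈u with All.lookup u⊆[n] k∈u
  ... | 1≤k , k≤n =
    ∈-complement⁺ n (complement n u) (∈-range⁺ 1≤k k≤n) (λ k∈c → proj₂ (∈-complement⁻ n u k∈c) k∈u)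

-- Both sides of the theorem are instances, definitionally:
-- DP s = PathsBelow (|s| ∸ ℓ(s)) (ℓ(s) ∸ 1) (uOf s) and IPC n t = DominatedSequences n (complement n t).
IsPathBelow : ℕ → ℕ → List ℕ → List Step → Set
IsPathBelow r k q P = count R P ≡ r × count U P ≡ k × WeaklyAboveLeft P q

PathsBelow : ℕ → ℕ → List ℕ → Set
PathsBelow r k q = Σ (List Step) (IsPathBelow r k q)

IsDominatedSequence : ℕ → List ℕ → List ℕ → Set
IsDominatedSequence n q c = All (λ x → 1 ≤ x × x ≤ n) c × Linked _≤_ c × Pointwise _≤_ c q

DominatedSequences : ℕ → List ℕ → Set
DominatedSequences n q = Σ (List ℕ) (IsDominatedSequence n q)

×-irrelevant : ∀ {A B : Set} → (∀ (a a′ : A) → a ≡ a′) → (∀ (b b′ : B) → b ≡ b′) →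
               ∀ (p p′ : A × B) → p ≡ p′
×-irrelevant A-irr B-irr (a , b) (a′ , b′) = cong₂ _,_ (A-irr a a′) (B-irr b b′)

IsDominatedSequence-irrelevant : ∀ {n q c} (p p′ : IsDominatedSequence n q c) → p ≡ p′
IsDominatedSequence-irrelevant = ×-irrelevant (All.irrelevant (×-irrelevant ≤-irrelevant ≤-irrelevant))
  (×-irrelevant (Linked.irrelevant ≤-irrelevant) (Pointwise.irrelevant ≤-irrelevant))

IsPathBelow-irrelevant : ∀ {r k q P} (p p′ : IsPathBelow r k q P) → p ≡ p′
IsPathBelow-irrelevant =
  ×-irrelevant ≡-irrelevant (×-irrelevant ≡-irrelevant (Pointwise.irrelevant ≤-irrelevant))

pathsBelow↔dominatedSequences : ∀ {r k q} → length q ≡ k →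
                                PathsBelow r k q ↔ DominatedSequences (suc r) q
pathsBelow↔dominatedSequences {r} {k} {q} |q|≡k = mk↔ₛ′ to from to∘from from∘to
  where
  to : PathsBelow r k q → DominatedSequences (suc r) q
  to (P , #R≡r , _ , P≤q) = upXs P , bounds , Linked.tail linked , P≤q
    where
    linked : Linked _≤_ (1 ∷ upXs P)
    linked = upXsFrom-linked 1 P
    bounds : All (λ x → 1 ≤ x × x ≤ suc r) (upXs P)
    bounds = All.zipWith (λ (lo , hi) → lo , ≤-trans hi (≤-reflexive (cong suc #R≡r)))
                         (∷-linked⁻ linked , upXsFrom-bounded 1 P)

  from : DominatedSequences (suc r) q → PathsBelow r k q
  from (c , bounds , sorted , c≤q) =
    pathFrom 1 (suc r) c ,
    countR-pathFrom 1 (suc r) c linked (All.map proj₂ bounds) ,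
    trans (countU-pathFrom 1 (suc r) c) (trans (Pointwise-length c≤q) |q|≡k) ,
    subst (λ c′ → Pointwise _≤_ c′ q) (sym (upXsFrom-pathFrom 1 (suc r) c linked)) c≤q
    where
    linked : Linked _≤_ (1 ∷ c)
    linked = ∷-linked⁺ (All.map proj₁ bounds) sorted

  to∘from : ∀ c → to (from c) ≡ c
  to∘from (c , bounds , sorted , _) = Σ-≡,≡→≡
    ( upXsFrom-pathFrom 1 (suc r) c (∷-linked⁺ (All.map proj₁ bounds) sorted)
    , IsDominatedSequence-irrelevant _ _)

  from∘to : ∀ P → from (to P) ≡ P
  from∘to (P , #R≡r , _) = Σ-≡,≡→≡
    (pathFrom-upXsFrom 1 P (cong suc #R≡r) , IsPathBelow-irrelevant {P = P} _ _)

proposition5p4 : (s : List ℕ) → IsComposition s → InteriorAtLeast2 s →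
                 DP s ↔ IPC (nOf s) (tOf s)
proposition5p4 s (_ , positive) interior =
  subst₂ (λ n q → DP s ↔ DominatedSequences n q) (sym n≡1+r) (sym t-complement)
         (pathsBelow↔dominatedSequences (length-uOf s))
  where
  n≡1+r : nOf s ≡ suc (sum s ∸ length s)
  n≡1+r = +-∸-assoc 1 (length≤sum positive)

  u-strictlyIncreasing : Linked _<_ (uOf s)
  u-strictlyIncreasing = subst (Linked _<_) (sym (uOf≡tildeSeqFrom positive))
    (tildeSeqFrom-strictlyIncreasing 0 s positive interior)

  u-bounded : All (λ b → 1 ≤ b × b ≤ nOf s) (uOf s)
  u-bounded = subst (All (λ b → 1 ≤ b × b ≤ nOf s)) (sym (uOf≡tildeSeqFrom positive))
    (All.zipWith id (tildeSeqFrom-positive 0 s positive , tildeSeqFrom-bounded 0 s positive))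

  t-complement : complement (nOf s) (tOf s) ≡ uOf s
  t-complement = complement-involutive u-strictlyIncreasing u-bounded
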